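{- Let $G=(V,E)$ be a connected Eulerian digraph and $s\in V$, and consider the chip-firing game on $G$ with sink $s$. Every minimal recurrent configuration $c$ has exactly one firing graph.
   Context: Digraphs are finite and simple; Eulerian means in-degree equals out-degree at every vertex. Chip-firing on $G$ with sink $s$ (i.e. on $G$ with all arcs of tail $s$ deleted): a configuration is a map $c:V\setminus\{s\}\to\mathbb{N}$. A vertex $v\neq s$ is active if $c(v)\ge\mathrm{outdeg}_G(v)\ge1$; firing $v$ subtracts $\mathrm{outdeg}_G(v)$ from $c(v)$ and adds one chip to each out-neighbour $w\ne s$ of $v$ (chips sent to $s$ vanish). Legal firing = firing an active vertex; $c\to^*d$ means reachable by legal firings; $c$ stable if no vertex is active; $c^\circ$ is the unique stable configuration reached from $c$. $c$ is accessible if for every configuration $d$ there is $d'$ with $d+d'\to^*c$; recurrent if stable and accessible. $c'\le c$ is componentwise; a recurrent $c$ is minimal if no recurrent $c'\ne c$ has $c'\le c$. Let $\beta(v)=1$ if $(s,v)\in E$ and $0$ otherwise. It is known that for recurrent $c$, $(c+\beta)^\circ=c$ and every legal firing sequence from $c+\beta$ to $c$ fires each vertex of $V\setminus\{s\}$ exactly once. A firing graph of a recurrent $c$: for a legal firing sequence $(w_1,\dots,w_k)$ from $c+\beta$ ending at $c$, the digraph with vertex set $V$ and arc set $\{(s,w_i):(s,w_i)\in E\}\cup\{(w_i,w_j):i<j,(w_i,w_j)\in E\}$ (different sequences may a priori give different firing graphs). -}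

module Defs where

open import Data.Nat using (ℕ; zero; suc; _+_; _∸_; _≤_; _<_)
open import Data.Fin using (Fin; _≟_)
open import Data.Fin.Properties using ()
open import Data.Bool using (Bool; true; false; if_then_else_; _∧_; not)
open import Data.List using (List; []; _∷_; map; allFin; length; lookup)
open import Data.Nat.ListAction using (sum)
open import Data.List.Membership.Propositional using (_∈_)
open import Data.Product using (Σ; ∃; ∃-syntax; _×_; _,_)
open import Data.Sum using (_⊎_)
open import Relation.Nullary using (¬_; does)
open import Relation.Binary.PropositionalEquality using (_≡_; _≢_)

record Digraph (n : ℕ) : Set where
  field
    E     : Fin n → Fin n → Bool
    loopless : ∀ v → E v v ≡ false
open Digraph public

module _ {n : ℕ} (G : Digraph n) where

  Arc : Fin n → Fin n → Set
  Arc u v = E G u v ≡ true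

  outdeg : Fin n → ℕ
  outdeg v = sum (map (λ w → if E G v w then 1 else 0) (allFin n))

  indeg : Fin n → ℕ
  indeg v = sum (map (λ u → if E G u v then 1 else 0) (allFin n))

  Eulerian : Set
  Eulerian = ∀ v → indeg v ≡ outdeg v

  -- walks in the underlying undirected graph
  data Walk : Fin n → Fin n → Set where
    here : ∀ {v} → Walk v v
    fwd  : ∀ {u v w} → Arc u v → Walk v w → Walk u w
    bwd  : ∀ {u v w} → Arc v u → Walk v w → Walk u w

  Connected : Set
  Connected = ∀ u v → Walk u v

-- A configuration V∖{s} → ℕ is represented
-- by a function Fin n → ℕ whose value at s is irrelevant: it is never
-- read by the firing rules, and all comparisons ignore it.
Config : ℕ → Set
Config n = Fin n → ℕ

module ChipFiring {n : ℕ} (G : Digraph n) (s : Fin n) where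

  _≈_ : Config n → Config n → Set
  c ≈ d = ∀ v → v ≢ s → c v ≡ d v

  _≤ᶜ_ : Config n → Config n → Set
  c ≤ᶜ d = ∀ v → v ≢ s → c v ≤ d v

  _⊕_ : Config n → Config n → Config n
  (c ⊕ d) v = c v + d v

  Active : Fin n → Config n → Set
  Active v c = v ≢ s × 1 ≤ outdeg G v × outdeg G v ≤ c v

  fire : Fin n → Config n → Config n
  fire v c w =
    (if does (w ≟ v) then c w ∸ outdeg G v else c w)
    + (if E G v w ∧ not (does (w ≟ s)) then 1 else 0)

  run : List (Fin n) → Config n → Config n
  run []       c = c
  run (v ∷ vs) c = run vs (fire v c)

  data Legal : Config n → List (Fin n) → Set where
    []  : ∀ {c} → Legal c []
    _∷_ : ∀ {c v vs} → Active v c → Legal (fire v c) vs → Legal c (v ∷ vs)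

  _→*_ : Config n → Config n → Set
  c →* d = Σ (List (Fin n)) λ ws → Legal c ws × run ws c ≈ d

  Stable : Config n → Set
  Stable c = ∀ v → ¬ Active v c

  Accessible : Config n → Set
  Accessible c = ∀ d → ∃[ d' ] ((d ⊕ d') →* c)

  Recurrent : Config n → Set
  Recurrent c = Stable c × Accessible c

  MinimalRecurrent : Config n → Set
  MinimalRecurrent c =
    Recurrent c × (∀ c' → Recurrent c' → c' ≤ᶜ c → c' ≈ c)

  β : Config n
  β v = if E G s v then 1 else 0

  FiringSeq : Config n → List (Fin n) → Set
  FiringSeq c ws = Legal (c ⊕ β) ws × run ws (c ⊕ β) ≈ c

  -- arc relation of the firing graph determined by the sequence ws
  -- (vertex set V; arcs (s,wᵢ) ∈ E and (wᵢ,wⱼ) ∈ E with i < j)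
  FGArc : List (Fin n) → Fin n → Fin n → Set
  FGArc ws u v =
    ((u ≡ s × v ∈ ws) ⊎
     (∃[ i ] ∃[ j ] (Data.Fin._<_ {length ws} i j × lookup ws i ≡ u × lookup ws j ≡ v)))
    × Arc G u v

  UniqueFiringGraph : Config n → Set
  UniqueFiringGraph c =
    (∃[ ws ] FiringSeq c ws)
    × (∀ ws₁ ws₂ → FiringSeq c ws₁ → FiringSeq c ws₂ →
         ∀ u v → (FGArc ws₁ u v → FGArc ws₂ u v) × (FGArc ws₂ u v → FGArc ws₁ u v))

-- Two firing sequences σ, τ from c + β to c both fire every non-sink exactly
-- once (least action), so their firing graphs can differ only if some arc
-- u → v between non-sinks is fired u-then-v in σ = C v D (u ∈ C) and
-- v-then-u in τ = A v B (u ∈ B).  By the abelian property, C followed by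
-- the residual of A is a legal prefix P that avoids v, fires everything A
-- fires and u besides; as v was active after A, after P it holds more than
-- outdeg v chips.  Completing P v to a firing sequence and counting chips
-- with the Eulerian condition shows c(v) ≥ 1 and that the surplus chip can
-- be removed: c − e_v returns to itself from c − e_v + β, and since v can be
-- loaded with arbitrarily many chips from multiples of β, c − e_v is
-- accessible.  This smaller recurrent configuration contradicts minimality.

module Submission where

open import Data.Nat using (ℕ; zero; suc; _+_; _*_; _∸_; _≤_; _<_; z≤n; s≤s)
open import Data.Nat.Properties hiding (_≟_)
open import Data.Fin using (Fin; _≟_)
import Data.Fin as F
open import Data.Bool using (Bool; true; false; if_then_else_; _∧_; not)
open import Data.List using (List; []; _∷_; map; allFin; length; lookup; _++_; tabulate; replicate; filter)
open import Data.Nat.ListAction using (sum)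
open import Data.List.Properties using (map-tabulate; ++-assoc)
open import Data.List.Membership.Propositional using (_∈_)
open import Data.List.Membership.Propositional.Properties using (∈-∃++; ∈-lookup)
open import Data.List.Relation.Unary.Any using (here; there; index)
open import Data.List.Relation.Unary.Any.Properties using (lookup-index)
open import Data.Product using (∃-syntax; _×_; _,_; proj₁; proj₂)
open import Data.Sum using (_⊎_; inj₁; inj₂)
open import Data.Empty using (⊥; ⊥-elim)
open import Function using (_∘_)
open import Relation.Nullary using (¬_; does; yes; no; ¬?)
open import Relation.Unary using (Decidable)
open import Relation.Binary.PropositionalEquality
open import Algebra.Properties.CommutativeMonoid.Sum +-0-commutativeMonoid using (sum-cong-≗; ∑-distrib-+; sum-replicate-zero) renaming (sum to ∑)
open import Algebra.Properties.CommutativeSemigroup +-commutativeSemigroup using (x∙yz≈xz∙y; x∙yz≈y∙xz; xy∙z≈xz∙y)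
open import Defs

∑-mono : ∀ {k} {f g : Fin k → ℕ} → (∀ x → f x ≤ g x) → ∑ f ≤ ∑ g
∑-mono {zero}  p = z≤n
∑-mono {suc k} p = +-mono-≤ (p F.zero) (∑-mono (p ∘ F.suc))

∑-mono-< : ∀ {k} {f g : Fin k → ℕ} → (∀ x → f x ≤ g x) → ∀ u → f u < g u → ∑ f < ∑ g
∑-mono-< {suc k} p F.zero    q = +-mono-<-≤ q (∑-mono (p ∘ F.suc))
∑-mono-< {suc k} p (F.suc u) q = +-mono-≤-< (p F.zero) (∑-mono-< (p ∘ F.suc) u q)

term≤∑ : ∀ {k} (f : Fin k → ℕ) u → f u ≤ ∑ f
term≤∑ f F.zero    = m≤m+n _ _
term≤∑ f (F.suc u) = ≤-trans (term≤∑ (f ∘ F.suc) u) (m≤n+m _ _)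

sum-allFin : ∀ {k} (h : Fin k → ℕ) → sum (map h (allFin k)) ≡ ∑ h
sum-allFin {k} h = trans (cong sum (map-tabulate (λ x → x) h)) (sum-tabulate h)
  where
  sum-tabulate : ∀ {m} (f : Fin m → ℕ) → sum (tabulate f) ≡ ∑ f
  sum-tabulate {zero}  f = refl
  sum-tabulate {suc m} f = cong (f F.zero +_) (sum-tabulate (f ∘ F.suc))

-- Kronecker delta on Fin k, written with the same test as the firing rule.
δ : ∀ {k} → Fin k → Fin k → ℕ
δ x y = if does (x ≟ y) then 1 else 0

δ-refl : ∀ {k} (x : Fin k) → δ x x ≡ 1
δ-refl x with x ≟ x
... | yes _  = refl
... | no x≢x = ⊥-elim (x≢x refl)

δ-≢ : ∀ {k} {x y : Fin k} → x ≢ y → δ x y ≡ 0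
δ-≢ {x = x} {y} x≢y with x ≟ y
... | yes x≡y = ⊥-elim (x≢y x≡y)
... | no _    = refl

δ-sym : ∀ {k} (x y : Fin k) → δ x y ≡ δ y x
δ-sym x y with x ≟ y
... | yes refl = sym (δ-refl x)
... | no x≢y   = sym (δ-≢ (x≢y ∘ sym))

δ-≤ : ∀ {k} {y : Fin k} {f : Fin k → ℕ} → 1 ≤ f y → ∀ x → δ x y ≤ f x
δ-≤ {y = y} fy x with x ≟ y
... | yes refl = fy
... | no _     = z≤n

∑-δ : ∀ {k} (x : Fin k) (f : Fin k → ℕ) → ∑ (λ u → δ u x * f u) ≡ f x
∑-δ {suc k} F.zero    f = begin
  (f F.zero + 0) + ∑ {k} (λ _ → 0)  ≡⟨ cong₂ _+_ (+-identityʳ (f F.zero)) (sum-replicate-zero k) ⟩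
  f F.zero + 0                      ≡⟨ +-identityʳ (f F.zero) ⟩
  f F.zero                          ∎
  where open ≡-Reasoning
∑-δ {suc k} (F.suc x) f = ∑-δ x (f ∘ F.suc)

count : ∀ {k} → Fin k → List (Fin k) → ℕ
count w []       = 0
count w (x ∷ xs) = δ w x + count w xs

count-++ : ∀ {k} (w : Fin k) l₁ l₂ → count w (l₁ ++ l₂) ≡ count w l₁ + count w l₂
count-++ w []       l₂ = refl
count-++ w (x ∷ l₁) l₂ = trans (cong (δ w x +_) (count-++ w l₁ l₂)) (sym (+-assoc (δ w x) _ _))

∈⇒count : ∀ {k} {x : Fin k} {l} → x ∈ l → 1 ≤ count x l
∈⇒count {x = x} {_ ∷ l} (here refl) = subst (λ d → 1 ≤ d + count x l) (sym (δ-refl x)) (s≤s z≤n)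
∈⇒count {x = x} {y ∷ l} (there x∈l) = ≤-trans (∈⇒count x∈l) (m≤n+m _ (δ x y))

count⇒∈ : ∀ {k} {x : Fin k} l → 1 ≤ count x l → x ∈ l
count⇒∈ {x = x} (y ∷ l) pos with x ≟ y
... | yes x≡y = here x≡y
... | no _    = there (count⇒∈ l pos)

count-replicate : ∀ {k} (w : Fin k) m u → count w (replicate m u) ≡ m * δ w u
count-replicate w zero    u = refl
count-replicate w (suc m) u = cong (δ w u +_) (count-replicate w m u)

once-later : ∀ {k} (w : Fin k) L₁ L₂ → count w (L₁ ++ L₂) ≡ 1 → 1 ≤ count w L₂ → count w L₁ ≡ 0
once-later w L₁ L₂ once in-L₂ = n≤0⇒n≡0 (+-cancelʳ-≤ 1 (count w L₁) 0 (begin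
  count w L₁ + 1           ≤⟨ +-monoʳ-≤ (count w L₁) in-L₂ ⟩
  count w L₁ + count w L₂  ≡⟨ count-++ w L₁ L₂ ⟨
  count w (L₁ ++ L₂)       ≡⟨ once ⟩
  1                        ∎))
  where open ≤-Reasoning

count-allFin : ∀ {k} (w : Fin k) → count w (allFin k) ≡ 1
count-allFin {k} w = begin
  count w (tabulate (λ x → x))  ≡⟨ count-tabulate (λ x → x) ⟩
  ∑ (λ u → δ w u)               ≡⟨ sum-cong-≗ (λ u → trans (δ-sym w u) (sym (*-identityʳ (δ u w)))) ⟩
  ∑ (λ u → δ u w * 1)           ≡⟨ ∑-δ w (λ _ → 1) ⟩
  1                             ∎
  where
  open ≡-Reasoning
  count-tabulate : ∀ {m} (h : Fin m → Fin k) → count w (tabulate h) ≡ ∑ (λ u → δ w (h u))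
  count-tabulate {zero}  h = refl
  count-tabulate {suc m} h = cong (δ w (h F.zero) +_) (count-tabulate (h ∘ F.suc))

module _ {k} {P : Fin k → Set} (P? : Decidable P) where

  count-filter-kept : ∀ {w} → P w → ∀ l → count w (filter P? l) ≡ count w l
  count-filter-kept pw []       = refl
  count-filter-kept {w} pw (x ∷ l) with P? x
  ... | yes _  = cong (δ w x +_) (count-filter-kept pw l)
  ... | no ¬px = trans (count-filter-kept pw l)
                   (sym (cong (_+ count w l) (δ-≢ {x = w} {x} λ { refl → ¬px pw })))

  count-filter-dropped : ∀ {w} → ¬ P w → ∀ l → count w (filter P? l) ≡ 0
  count-filter-dropped ¬pw []       = refl
  count-filter-dropped {w} ¬pw (x ∷ l) with P? x
  ... | yes px = cong₂ _+_ (δ-≢ {x = w} {x} λ { refl → ¬pw px }) (count-filter-dropped ¬pw l)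
  ... | no _   = count-filter-dropped ¬pw l

module Firing {n : ℕ} (G : Digraph n) (s : Fin n) where
  open ChipFiring G s

  od : Fin n → ℕ
  od = outdeg G

  gain : Fin n → Fin n → ℕ
  gain v w = if E G v w ∧ not (does (w ≟ s)) then 1 else 0

  received : Fin n → List (Fin n) → ℕ
  received w []       = 0
  received w (x ∷ xs) = gain x w + received w xs

  unit : Fin n → Config n
  unit v w = δ w v

  scale : ℕ → Config n → Config n
  scale k D w = k * D w

  gain-arc : ∀ {u w} → Arc G u w → w ≢ s → gain u w ≡ 1
  gain-arc {u} {w} uw w≢s with w ≟ s
  ... | yes w≡s = ⊥-elim (w≢s w≡s)
  ... | no _    rewrite uw = refl

  gain-nonarc : ∀ {u w} → E G u w ≡ false → gain u w ≡ 0
  gain-nonarc eq rewrite eq = refl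

  ≈-refl : {Y : Config n} → Y ≈ Y
  ≈-refl w _ = refl

  ≈-sym : {Y Z : Config n} → Y ≈ Z → Z ≈ Y
  ≈-sym p w w≢s = sym (p w w≢s)

  ≈-trans : {X Y Z : Config n} → X ≈ Y → Y ≈ Z → X ≈ Z
  ≈-trans p q w w≢s = trans (p w w≢s) (q w w≢s)

  ≡⇒≈ : {Y Z : Config n} → Y ≡ Z → Y ≈ Z
  ≡⇒≈ refl = ≈-refl

  fire-balance : ∀ v (Y : Config n) → od v ≤ Y v → ∀ w →
                 fire v Y w + δ w v * od v ≡ Y w + gain v w
  fire-balance v Y odv≤ w with w ≟ v
  ... | yes refl = begin
    (Y w ∸ od w + gain w w) + (od w + 0)  ≡⟨ cong ((Y w ∸ od w + gain w w) +_) (+-identityʳ (od w)) ⟩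
    (Y w ∸ od w + gain w w) + od w        ≡⟨ xy∙z≈xz∙y (Y w ∸ od w) (gain w w) (od w) ⟩
    (Y w ∸ od w + od w) + gain w w        ≡⟨ cong (_+ gain w w) (m∸n+n≡m odv≤) ⟩
    Y w + gain w w                        ∎
    where open ≡-Reasoning
  ... | no _ = +-identityʳ _

  fire-≥ : ∀ v (Y : Config n) w → w ≢ v → Y w ≤ fire v Y w
  fire-≥ v Y w w≢v with w ≟ v
  ... | yes w≡v = ⊥-elim (w≢v w≡v)
  ... | no _    = m≤m+n _ _

  fire-≤ : ∀ v (Y : Config n) w → fire v Y w ≤ Y w + gain v w
  fire-≤ v Y w with w ≟ v
  ... | yes _ = +-monoˡ-≤ (gain v w) (m∸n≤m (Y w) (od v))
  ... | no _  = ≤-refl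

  fire-resp : ∀ v {Y Z : Config n} → Y ≈ Z → fire v Y ≈ fire v Z
  fire-resp v {Y} {Z} Y≈Z w w≢s with w ≟ v
  ... | yes _ = cong (λ z → z ∸ od v + gain v w) (Y≈Z w w≢s)
  ... | no _  = cong (_+ gain v w) (Y≈Z w w≢s)

  Active-resp : ∀ {v} {Y Z : Config n} → Y ≈ Z → Active v Y → Active v Z
  Active-resp Y≈Z (v≢s , od≥1 , odv≤) = v≢s , od≥1 , subst (od _ ≤_) (Y≈Z _ v≢s) odv≤

  Legal-resp : ∀ {Y Z ws} → Y ≈ Z → Legal Y ws → Legal Z ws
  Legal-resp Y≈Z []      = []
  Legal-resp Y≈Z (a ∷ l) = Active-resp Y≈Z a ∷ Legal-resp (fire-resp _ Y≈Z) l

  run-resp : ∀ ws {Y Z : Config n} → Y ≈ Z → run ws Y ≈ run ws Z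
  run-resp []       Y≈Z = Y≈Z
  run-resp (v ∷ ws) Y≈Z = run-resp ws (fire-resp v Y≈Z)

  run-++ : ∀ l₁ l₂ (Y : Config n) → run (l₁ ++ l₂) Y ≡ run l₂ (run l₁ Y)
  run-++ []       l₂ Y = refl
  run-++ (x ∷ l₁) l₂ Y = run-++ l₁ l₂ (fire x Y)

  Legal-split : ∀ {Y} l₁ l₂ → Legal Y (l₁ ++ l₂) → Legal Y l₁ × Legal (run l₁ Y) l₂
  Legal-split []       l₂ l       = [] , l
  Legal-split (x ∷ l₁) l₂ (a ∷ l) = let (p , q) = Legal-split l₁ l₂ l in (a ∷ p) , q

  Legal-join : ∀ {Y} l₁ l₂ → Legal Y l₁ → Legal (run l₁ Y) l₂ → Legal Y (l₁ ++ l₂)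
  Legal-join []       l₂ []      q = q
  Legal-join (x ∷ l₁) l₂ (a ∷ p) q = a ∷ Legal-join l₁ l₂ p q

  Legal-nonsink : ∀ {Y ws x} → Legal Y ws → x ∈ ws → x ≢ s
  Legal-nonsink ((v≢s , _) ∷ _) (here refl) = v≢s
  Legal-nonsink (_ ∷ l)         (there x∈)  = Legal-nonsink l x∈

  fire-⊕ : ∀ v (Y D : Config n) → od v ≤ Y v → ∀ w → fire v (Y ⊕ D) w ≡ fire v Y w + D w
  fire-⊕ v Y D odv≤ w = +-cancelʳ-≡ (δ w v * od v) _ _ (begin
    fire v (Y ⊕ D) w + δ w v * od v  ≡⟨ fire-balance v (Y ⊕ D) (≤-trans odv≤ (m≤m+n _ _)) w ⟩
    (Y w + D w) + gain v w           ≡⟨ xy∙z≈xz∙y (Y w) (D w) (gain v w) ⟩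
    (Y w + gain v w) + D w           ≡⟨ cong (_+ D w) (sym (fire-balance v Y odv≤ w)) ⟩
    (fire v Y w + δ w v * od v) + D w ≡⟨ xy∙z≈xz∙y (fire v Y w) (δ w v * od v) (D w) ⟩
    (fire v Y w + D w) + δ w v * od v ∎)
    where open ≡-Reasoning

  Legal-add : ∀ {Y Z D ws} → Legal Y ws → Z ≈ (Y ⊕ D) → Legal Z ws × run ws Z ≈ (run ws Y ⊕ D)
  Legal-add []                             Z≈ = [] , Z≈
  Legal-add {Y} {Z} {D} (a@(v≢s , od≥1 , odv≤) ∷ l) Z≈ =
    let (lZ , runZ) = Legal-add l (≈-trans (fire-resp _ Z≈) (λ w _ → fire-⊕ _ Y D odv≤ w))
    in ((v≢s , od≥1 , subst (od _ ≤_) (sym (Z≈ _ v≢s)) (≤-trans odv≤ (m≤m+n _ _))) ∷ lZ) , runZ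

  Legal-remove : ∀ {Y Z D ws} → Legal Z ws → Z ≈ (Y ⊕ D) → (∀ x → 0 < count x ws → D x ≡ 0) →
                 Legal Y ws × run ws Z ≈ (run ws Y ⊕ D)
  Legal-remove []                               Z≈ unfired = [] , Z≈
  Legal-remove {Y} {Z} {D} {v ∷ ws} ((v≢s , od≥1 , odv≤) ∷ l) Z≈ unfired =
    let Dv≡0 = unfired v (subst (λ d → 0 < d + count v ws) (sym (δ-refl v)) (s≤s z≤n))
        odv≤Yv = subst (od v ≤_) (trans (Z≈ v v≢s) (trans (cong (Y v +_) Dv≡0) (+-identityʳ _))) odv≤
        (lY , runY) = Legal-remove l (≈-trans (fire-resp v Z≈) (λ w _ → fire-⊕ v Y D odv≤Yv w))
                                    (λ x pos → unfired x (≤-trans pos (m≤n+m _ _)))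
    in ((v≢s , od≥1 , odv≤Yv) ∷ lY) , runY

  δ-od : ∀ w v → δ w v * od w ≡ δ w v * od v
  δ-od w v with w ≟ v
  ... | yes refl = refl
  ... | no _     = refl

  run-balance : ∀ {Y ws} → Legal Y ws → ∀ w → run ws Y w + count w ws * od w ≡ Y w + received w ws
  run-balance []                            w = trans (+-identityʳ _) (sym (+-identityʳ _))
  run-balance {Y} {v ∷ ws} ((_ , _ , odv≤) ∷ l) w = begin
    run ws (fire v Y) w + (δ w v + count w ws) * od w
      ≡⟨ cong (run ws (fire v Y) w +_) (*-distribʳ-+ (od w) (δ w v) (count w ws)) ⟩
    run ws (fire v Y) w + (δ w v * od w + count w ws * od w)
      ≡⟨ x∙yz≈xz∙y (run ws (fire v Y) w) (δ w v * od w) (count w ws * od w) ⟩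
    (run ws (fire v Y) w + count w ws * od w) + δ w v * od w
      ≡⟨ cong (_+ δ w v * od w) (run-balance l w) ⟩
    (fire v Y w + received w ws) + δ w v * od w
      ≡⟨ xy∙z≈xz∙y (fire v Y w) (received w ws) _ ⟩
    (fire v Y w + δ w v * od w) + received w ws
      ≡⟨ cong (λ d → fire v Y w + d + received w ws) (δ-od w v) ⟩
    (fire v Y w + δ w v * od v) + received w ws
      ≡⟨ cong (_+ received w ws) (fire-balance v Y odv≤ w) ⟩
    (Y w + gain v w) + received w ws
      ≡⟨ +-assoc (Y w) _ _ ⟩
    Y w + (gain v w + received w ws) ∎
    where
    open ≡-Reasoning

  run-unfired : ∀ {Y ws v} → Legal Y ws → count v ws ≡ 0 → run ws Y v ≡ Y v + received v ws
  run-unfired {Y} {ws} {v} l cv≡0 = trans (sym (+-identityʳ _))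
    (trans (cong (λ k → run ws Y v + k * od v) (sym cv≡0)) (run-balance l v))

  received-∑ : ∀ w ws → received w ws ≡ ∑ (λ u → count u ws * gain u w)
  received-∑ w []       = sym (sum-replicate-zero n)
  received-∑ w (x ∷ ws) = begin
    gain x w + received w ws
      ≡⟨ cong₂ _+_ (sym (∑-δ x (λ u → gain u w))) (received-∑ w ws) ⟩
    ∑ (λ u → δ u x * gain u w) + ∑ (λ u → count u ws * gain u w)
      ≡⟨ sym (∑-distrib-+ (λ u → δ u x * gain u w) (λ u → count u ws * gain u w)) ⟩
    ∑ (λ u → δ u x * gain u w + count u ws * gain u w)
      ≡⟨ sum-cong-≗ (λ u → sym (*-distribʳ-+ (gain u w) (δ u x) (count u ws))) ⟩
    ∑ (λ u → (δ u x + count u ws) * gain u w) ∎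
    where open ≡-Reasoning

  received-mono : ∀ w l₁ l₂ → (∀ u → count u l₁ ≤ count u l₂) → received w l₁ ≤ received w l₂
  received-mono w l₁ l₂ le = subst₂ _≤_ (sym (received-∑ w l₁)) (sym (received-∑ w l₂))
                                (∑-mono (λ u → *-monoˡ-≤ (gain u w) (le u)))

  Legal-budget : ∀ {Y} ws → (∀ w → count w ws * od w ≤ Y w) →
                 (∀ w → 0 < count w ws → w ≢ s × 1 ≤ od w) → Legal Y ws
  Legal-budget [] _ _ = []
  Legal-budget {Y} (x ∷ ws) budget ok =
    let x-fired = subst (λ d → 0 < d + count x ws) (sym (δ-refl x)) (s≤s z≤n)
        (x≢s , od≥1) = ok x x-fired
        odx≤ = ≤-trans (≤-trans (≤-reflexive (sym (*-identityˡ (od x)))) (*-monoˡ-≤ (od x) x-fired)) (budget x)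
    in (x≢s , od≥1 , odx≤) ∷ Legal-budget ws (budget′ odx≤) (λ w pos → ok w (≤-trans pos (m≤n+m _ _)))
    where
    budget′ : od x ≤ Y x → ∀ w → count w ws * od w ≤ fire x Y w
    budget′ odx≤ w = +-cancelʳ-≤ (δ w x * od x) _ _ (begin
      count w ws * od w + δ w x * od x   ≡⟨ cong (count w ws * od w +_) (sym (δ-od w x)) ⟩
      count w ws * od w + δ w x * od w   ≡⟨ +-comm (count w ws * od w) _ ⟩
      δ w x * od w + count w ws * od w   ≡⟨ *-distribʳ-+ (od w) (δ w x) (count w ws) ⟨
      (δ w x + count w ws) * od w        ≤⟨ budget w ⟩
      Y w                                ≤⟨ m≤m+n (Y w) (gain x w) ⟩
      Y w + gain x w                     ≡⟨ sym (fire-balance x Y odx≤ w) ⟩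
      fire x Y w + δ w x * od x          ∎)
      where
      open ≤-Reasoning

  unit-unfired : ∀ {v ws} → count v ws ≡ 0 → ∀ x → 0 < count x ws → unit v x ≡ 0
  unit-unfired {v} {ws} cv≡0 x pos = δ-≢ {x = x} {v} λ { refl → <-irrefl refl (subst (0 <_) cv≡0 pos) }

  remove-surplus-chip : ∀ {Y Z : Config n} {v} P a → Z ≈ (Y ⊕ unit v) → Legal Z (P ++ v ∷ a) →
                        count v P ≡ 0 → count v a ≡ 0 → od v < run P Z v →
                        Legal Y (P ++ v ∷ a) × run (P ++ v ∷ a) Z ≈ (run (P ++ v ∷ a) Y ⊕ unit v)
  remove-surplus-chip {Y} {Z} {v} P a Z≈ l cvP cva surplus with Legal-split P (v ∷ a) l
  ... | lP , (v≢s , od≥1 , _) ∷ la = Legal-join P (v ∷ a) lPY ((v≢s , od≥1 , odv≤) ∷ laY) , result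
    where
    removeP = Legal-remove lP Z≈ (unit-unfired {ws = P} cvP)
    lPY : Legal Y P
    lPY = proj₁ removeP
    odv≤ : od v ≤ run P Y v
    odv≤ = +-cancelˡ-≤ 1 (od v) _ (≤-trans surplus (≤-reflexive
             (trans (proj₂ removeP v v≢s) (trans (cong (run P Y v +_) (δ-refl v)) (+-comm _ 1)))))
    removeA = Legal-remove la (≈-trans (fire-resp v (proj₂ removeP)) (λ w _ → fire-⊕ v (run P Y) (unit v) odv≤ w))
                              (unit-unfired {ws = a} cva)
    laY : Legal (fire v (run P Y)) a
    laY = proj₁ removeA
    result : run (P ++ v ∷ a) Z ≈ (run (P ++ v ∷ a) Y ⊕ unit v)
    result w w≢s = begin
      run (P ++ v ∷ a) Z w             ≡⟨ cong (λ f → f w) (run-++ P (v ∷ a) Z) ⟩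
      run a (fire v (run P Z)) w       ≡⟨ proj₂ removeA w w≢s ⟩
      run a (fire v (run P Y)) w + δ w v ≡⟨ cong (λ f → f w + δ w v) (run-++ P (v ∷ a) Y) ⟨
      run (P ++ v ∷ a) Y w + δ w v    ∎
      where open ≡-Reasoning

  repeat : ∀ {Y D π} → Legal (Y ⊕ D) π → run π (Y ⊕ D) ≈ Y → ∀ k →
           ∃[ ws ] Legal (Y ⊕ scale k D) ws × run ws (Y ⊕ scale k D) ≈ Y
  repeat {Y} lπ eπ zero = [] , [] , λ w _ → +-identityʳ (Y w)
  repeat {Y} {D} {π} lπ eπ (suc k) =
    let (ws , lws , ews) = repeat lπ eπ k
        (lπ′ , eπ′) = Legal-add {D = scale k D} lπ (λ w _ → sym (+-assoc (Y w) (D w) _))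
        back : run π (Y ⊕ scale (suc k) D) ≈ (Y ⊕ scale k D)
        back = ≈-trans eπ′ (λ w w≢s → cong (_+ scale k D w) (eπ w w≢s))
    in π ++ ws , Legal-join π ws lπ′ (Legal-resp (≈-sym back) lws) ,
       ≈-trans (≡⇒≈ (run-++ π ws _)) (≈-trans (run-resp ws back) ews)

module Abelian {n : ℕ} (G : Digraph n) (s : Fin n) where
  open ChipFiring G s
  open Firing G s

  fire-commute : ∀ x y (Y : Config n) → od x ≤ Y x → od y ≤ Y y → x ≢ y →
                 fire x (fire y Y) ≈ fire y (fire x Y)
  fire-commute x y Y odx≤ ody≤ x≢y w _ = +-cancelʳ-≡ (δ w x * od x + δ w y * od y) _ _ (begin
    fire x (fire y Y) w + (δ w x * od x + δ w y * od y) ≡⟨ both x y odx≤ ody≤ x≢y ⟩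
    Y w + (gain y w + gain x w)                         ≡⟨ cong (Y w +_) (+-comm (gain y w) _) ⟩
    Y w + (gain x w + gain y w)                         ≡⟨ both y x ody≤ odx≤ (x≢y ∘ sym) ⟨
    fire y (fire x Y) w + (δ w y * od y + δ w x * od x) ≡⟨ cong (fire y (fire x Y) w +_) (+-comm (δ w y * od y) _) ⟩
    fire y (fire x Y) w + (δ w x * od x + δ w y * od y) ∎)
    where
    open ≡-Reasoning
    both : ∀ a b → od a ≤ Y a → od b ≤ Y b → a ≢ b →
           fire a (fire b Y) w + (δ w a * od a + δ w b * od b) ≡ Y w + (gain b w + gain a w)
    both a b oda≤ odb≤ a≢b = begin
      fire a (fire b Y) w + (δ w a * od a + δ w b * od b) ≡⟨ +-assoc (fire a (fire b Y) w) _ _ ⟨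
      (fire a (fire b Y) w + δ w a * od a) + δ w b * od b ≡⟨ cong (_+ δ w b * od b) (fire-balance a (fire b Y) (≤-trans oda≤ (fire-≥ b Y a a≢b)) w) ⟩
      (fire b Y w + gain a w) + δ w b * od b              ≡⟨ xy∙z≈xz∙y (fire b Y w) (gain a w) _ ⟩
      (fire b Y w + δ w b * od b) + gain a w              ≡⟨ cong (_+ gain a w) (fire-balance b Y odb≤ w) ⟩
      (Y w + gain b w) + gain a w                         ≡⟨ +-assoc (Y w) _ _ ⟩
      Y w + (gain b w + gain a w)                         ∎

  Active-fire : ∀ {x} y Y → Active x Y → x ≢ y → Active x (fire y Y)
  Active-fire {x} y Y (x≢s , od≥1 , odx≤) x≢y = x≢s , od≥1 , ≤-trans odx≤ (fire-≥ y Y x x≢y)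

  exchange : ∀ {Y a b} → Legal Y a → Active b Y →
    (∃[ r ] Legal (fire b Y) r × run r (fire b Y) ≈ run a Y × (∀ w → count w a ≡ δ w b + count w r))
    ⊎ (count b a ≡ 0 × Legal (fire b Y) a × Active b (run a Y))
  exchange {Y} {[]}    []         actb = inj₂ (refl , [] , actb)
  exchange {Y} {x ∷ a} {b} (actx ∷ l) actb with x ≟ b
  ... | yes refl = inj₁ (a , l , ≈-refl , λ w → refl)
  ... | no x≢b with exchange l (Active-fire x Y actb (x≢b ∘ sym))
  ...   | inj₁ (r , lr , er , cr) =
          inj₁ (x ∷ r , (Active-fire b Y actx x≢b ∷ Legal-resp swap lr) ,
                ≈-trans (run-resp r (≈-sym swap)) er ,
                λ w → trans (cong (δ w x +_) (cr w)) (x∙yz≈y∙xz (δ w x) (δ w b) (count w r)))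
    where
    swap : fire b (fire x Y) ≈ fire x (fire b Y)
    swap = ≈-sym (fire-commute x b Y (proj₂ (proj₂ actx)) (proj₂ (proj₂ actb)) x≢b)
  ...   | inj₂ (cb≡0 , lb , actb′) =
          inj₂ (trans (cong (_+ count b a) (δ-≢ (x≢b ∘ sym))) cb≡0 ,
                (Active-fire b Y actx x≢b ∷ Legal-resp swap lb) , actb′)
    where
    swap : fire b (fire x Y) ≈ fire x (fire b Y)
    swap = ≈-sym (fire-commute x b Y (proj₂ (proj₂ actx)) (proj₂ (proj₂ actb)) x≢b)

  residual : ∀ {Y a bs} → Legal Y a → Legal Y bs →
             ∃[ r ] Legal (run bs Y) r × (∀ w → count w r ≡ count w a ∸ count w bs)
  residual {Y} {a} {[]} la [] = a , la , λ w → refl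
  residual {Y} {a} {b ∷ bs} la (actb ∷ lbs) with exchange la actb
  ... | inj₁ (r₁ , lr₁ , _ , cr₁) =
        let (r , lr , cr) = residual lr₁ lbs
        in r , lr , λ w → begin
             count w r                            ≡⟨ cr w ⟩
             count w r₁ ∸ count w bs              ≡⟨ cong (_∸ count w bs) (m+n∸m≡n (δ w b) (count w r₁)) ⟨
             δ w b + count w r₁ ∸ δ w b ∸ count w bs ≡⟨ cong (λ d → d ∸ δ w b ∸ count w bs) (cr₁ w) ⟨
             count w a ∸ δ w b ∸ count w bs       ≡⟨ ∸-+-assoc (count w a) (δ w b) (count w bs) ⟩
             count w a ∸ (δ w b + count w bs)     ∎
    where open ≡-Reasoning
  ... | inj₂ (cb≡0 , lba , _) =
        let (r , lr , cr) = residual lba lbs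
        in r , lr , λ w → trans (cr w) (trans (cong (_∸ count w bs) (sym (unfired-b w)))
                                              (∸-+-assoc (count w a) (δ w b) (count w bs)))
    where
    unfired-b : ∀ w → count w a ∸ δ w b ≡ count w a
    unfired-b w with w ≟ b
    ... | yes refl = trans (cong (_∸ 1) cb≡0) (sym cb≡0)
    ... | no _     = refl

  complete : ∀ {Y a d bs} → Legal Y a → run a Y ≈ d → Stable d → Legal Y bs →
             ∃[ r ] Legal (run bs Y) r × run r (run bs Y) ≈ d × (∀ w → count w a ≡ count w bs + count w r)
  complete {Y} {a} {d} {[]} la ea std [] = a , la , ea , λ w → refl
  complete {Y} {a} {d} {b ∷ bs} la ea std (actb ∷ lbs) with exchange la actb
  ... | inj₁ (r₁ , lr₁ , er₁ , cr₁) =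
        let (r , lr , er , cr) = complete lr₁ (≈-trans er₁ ea) std lbs
        in r , lr , er , λ w → trans (cr₁ w) (trans (cong (δ w b +_) (cr w)) (sym (+-assoc (δ w b) _ _)))
  ... | inj₂ (_ , _ , actb′) = ⊥-elim (std _ (Active-resp ea actb′))

  same-counts : ∀ {Y a b d d′} → Legal Y a → run a Y ≈ d → Stable d →
                Legal Y b → run b Y ≈ d′ → Stable d′ → ∀ w → count w a ≡ count w b
  same-counts la ea std lb eb std′ with complete la ea std lb
  ... | []    , _ , _ , cr = λ w → trans (cr w) (+-identityʳ _)
  ... | x ∷ _ , actx ∷ _ , _ , _ = ⊥-elim (std′ x (Active-resp eb actx))

  -- If v is active after A, and C fires an in-neighbour u of v that A does not
  -- fire, neither firing v, then C followed by the residual of A is a legal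
  -- prefix P that avoids v and leaves more than outdeg v chips on v: P fires
  -- everything A fires and u besides, so v receives strictly more.
  surplus-prefix : ∀ {Y A C u v} → Legal Y A → Legal Y C → Active v (run A Y) → Arc G u v →
                   count v A ≡ 0 → count v C ≡ 0 → count u A ≡ 0 → u ∈ C →
                   ∃[ P ] Legal Y P × count v P ≡ 0 × od v < run P Y v
  surplus-prefix {Y} {A} {C} {u} {v} lA lC (v≢s , _ , odv≤) uv cvA cvC cuA u∈C =
    P , lP , cvP , (begin-strict
      od v               ≤⟨ odv≤ ⟩
      run A Y v          ≡⟨ run-unfired lA cvA ⟩
      Y v + received v A <⟨ +-monoʳ-< (Y v) more-received ⟩
      Y v + received v P ≡⟨ run-unfired lP cvP ⟨
      run P Y v          ∎)
    where
    open ≤-Reasoning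
    res = residual lA lC
    r = proj₁ res
    P = C ++ r
    lP : Legal Y P
    lP = Legal-join C r lC (proj₁ (proj₂ res))
    count-P : ∀ w → count w P ≡ count w C + (count w A ∸ count w C)
    count-P w = trans (count-++ w C r) (cong (count w C +_) (proj₂ (proj₂ res) w))
    cvP : count v P ≡ 0
    cvP = trans (count-P v) (cong₂ (λ x y → x + (y ∸ x)) cvC cvA)
    A≤P : ∀ w → count w A ≤ count w P
    A≤P w = subst (count w A ≤_) (sym (count-P w)) (m≤n+m∸n (count w A) (count w C))
    u-sends-more : count u A * gain u v < count u P * gain u v
    u-sends-more = begin-strict
      count u A * gain u v ≡⟨ cong (_* gain u v) cuA ⟩
      0                    <⟨ ∈⇒count u∈C ⟩
      count u C            ≤⟨ m≤m+n (count u C) _ ⟩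
      count u C + (count u A ∸ count u C) ≡⟨ count-P u ⟨
      count u P            ≡⟨ *-identityʳ (count u P) ⟨
      count u P * 1        ≡⟨ cong (count u P *_) (gain-arc uv v≢s) ⟨
      count u P * gain u v ∎
    more-received : received v A < received v P
    more-received = subst₂ _<_ (sym (received-∑ v A)) (sym (received-∑ v P))
      (∑-mono-< (λ w → *-monoˡ-≤ (gain w v) (A≤P w)) u u-sends-more)

module Degrees {n : ℕ} (G : Digraph n) (s : Fin n) where
  open ChipFiring G s
  open Firing G s

  bit : Bool → ℕ
  bit b = if b then 1 else 0

  nonSinks : List (Fin n)
  nonSinks = filter (λ u → ¬? (u ≟ s)) (allFin n)

  count-nonSinks : ∀ {w} → w ≢ s → count w nonSinks ≡ 1
  count-nonSinks {w} w≢s = trans (count-filter-kept (λ u → ¬? (u ≟ s)) w≢s (allFin n)) (count-allFin w)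

  count-nonSinks-sink : count s nonSinks ≡ 0
  count-nonSinks-sink = count-filter-dropped (λ u → ¬? (u ≟ s)) (λ s≢s → s≢s refl) (allFin n)

  count-nonSinks-≤1 : ∀ w → count w nonSinks ≤ 1
  count-nonSinks-≤1 w with w ≟ s
  ... | yes refl = subst (_≤ 1) (sym count-nonSinks-sink) z≤n
  ... | no w≢s   = ≤-reflexive (count-nonSinks w≢s)

  gain-off-sink : ∀ u {w} → w ≢ s → gain u w ≡ bit (E G u w)
  gain-off-sink u {w} w≢s with w ≟ s | E G u w
  ... | yes w≡s | _     = ⊥-elim (w≢s w≡s)
  ... | no _    | true  = refl
  ... | no _    | false = refl

  received-nonSinks : ∀ {w} → w ≢ s → received w nonSinks + β w ≡ indeg G w
  received-nonSinks {w} w≢s = begin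
    received w nonSinks + β w
      ≡⟨ cong₂ _+_ (received-∑ w nonSinks) (sym (∑-δ s (λ u → bit (E G u w)))) ⟩
    ∑ (λ u → count u nonSinks * gain u w) + ∑ (λ u → δ u s * bit (E G u w))
      ≡⟨ ∑-distrib-+ (λ u → count u nonSinks * gain u w) (λ u → δ u s * bit (E G u w)) ⟨
    ∑ (λ u → count u nonSinks * gain u w + δ u s * bit (E G u w))
      ≡⟨ sum-cong-≗ in-arc ⟩
    ∑ (λ u → bit (E G u w))
      ≡⟨ sum-allFin (λ u → bit (E G u w)) ⟨
    indeg G w ∎
    where
    open ≡-Reasoning
    -- the arc u → w is counted once: by β if u = s, by firing u otherwise
    in-arc : ∀ u → count u nonSinks * gain u w + δ u s * bit (E G u w) ≡ bit (E G u w)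
    in-arc u with u ≟ s
    ... | yes refl = trans (cong (λ k → k * gain s w + (bit (E G s w) + 0)) count-nonSinks-sink)
                           (+-identityʳ (bit (E G s w)))
    ... | no u≢s   = trans (cong (λ k → k * gain u w + 0) (count-nonSinks u≢s))
                           (trans (+-identityʳ _) (trans (+-identityʳ _) (gain-off-sink u w≢s)))

  outdeg-pos : ∀ {v w} → Arc G v w → 1 ≤ od v
  outdeg-pos {v} {w} vw = subst (1 ≤_) (sym (sum-allFin (λ x → bit (E G v x))))
                            (≤-trans (≤-reflexive (cong bit (sym vw))) (term≤∑ (λ x → bit (E G v x)) w))

  indeg-pos : ∀ {u w} → Arc G u w → 1 ≤ indeg G w
  indeg-pos {u} {w} uw = subst (1 ≤_) (sym (sum-allFin (λ x → bit (E G x w))))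
                           (≤-trans (≤-reflexive (cong bit (sym uw))) (term≤∑ (λ x → bit (E G x w)) u))

  -- In a connected Eulerian digraph every non-sink has an outgoing arc: the
  -- first step of a walk to s leaves it either by an out-arc or by an in-arc,
  -- and indeg = outdeg.
  nonsink-outdeg-pos : Connected G → Eulerian G → ∀ w → w ≢ s → 1 ≤ od w
  nonsink-outdeg-pos conn eul w w≢s = first-step (conn w s)
    where
    first-step : Walk G w s → 1 ≤ od w
    first-step here        = ⊥-elim (w≢s refl)
    first-step (fwd wv _)  = outdeg-pos wv
    first-step (bwd vw _)  = subst (1 ≤_) (eul w) (indeg-pos vw)

  arc-irreflexive : ∀ {u w} → Arc G u w → u ≢ w
  arc-irreflexive {u} uu refl with trans (sym uu) (loopless G u)
  ... | ()

module _ {A : Set} where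

  data Before (u v : A) : List A → Set where
    now   : ∀ {xs} → v ∈ xs → Before u v (u ∷ xs)
    later : ∀ {x xs} → Before u v xs → Before u v (x ∷ xs)

  split-at-earlier : ∀ {u v L} → Before u v L → ∃[ C ] ∃[ D ] L ≡ C ++ u ∷ D × v ∈ D
  split-at-earlier (now {xs} v∈) = [] , xs , refl , v∈
  split-at-earlier (later {x} b) =
    let (C , D , eq , v∈D) = split-at-earlier b in x ∷ C , D , cong (x ∷_) eq , v∈D

  split-at-later : ∀ {u v L} → Before u v L → ∃[ C ] ∃[ D ] L ≡ C ++ v ∷ D × u ∈ C
  split-at-later {u} (now v∈) = let (ys , zs , eq) = ∈-∃++ v∈ in u ∷ ys , zs , cong (u ∷_) eq , here refl
  split-at-later (later {x} b) =
    let (C , D , eq , u∈C) = split-at-later b in x ∷ C , D , cong (x ∷_) eq , there u∈C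

  Before-∈ : ∀ {u v L} → Before u v L → u ∈ L × v ∈ L
  Before-∈ (now v∈)  = here refl , there v∈
  Before-∈ (later b) = let (u∈ , v∈) = Before-∈ b in there u∈ , there v∈

  Before-dichotomy : ∀ {u v} L → u ∈ L → v ∈ L → u ≢ v → Before u v L ⊎ Before v u L
  Before-dichotomy (x ∷ L) (here refl) (here refl) u≢v = ⊥-elim (u≢v refl)
  Before-dichotomy (x ∷ L) (here refl) (there v∈)  _   = inj₁ (now v∈)
  Before-dichotomy (x ∷ L) (there u∈)  (here refl) _   = inj₂ (now u∈)
  Before-dichotomy (x ∷ L) (there u∈)  (there v∈)  u≢v with Before-dichotomy L u∈ v∈ u≢v
  ... | inj₁ b = inj₁ (later b)
  ... | inj₂ b = inj₂ (later b)

  index⇒Before : ∀ {u v} L (i j : Fin (length L)) → i F.< j → lookup L i ≡ u → lookup L j ≡ v → Before u v L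
  index⇒Before (x ∷ L) F.zero    (F.suc j) _         refl refl = now (∈-lookup j)
  index⇒Before (x ∷ L) (F.suc i) (F.suc j) (s≤s i<j) ≡u   ≡v   = later (index⇒Before L i j i<j ≡u ≡v)

  Before⇒index : ∀ {u v L} → Before u v L →
                 ∃[ i ] ∃[ j ] (F._<_ {length L} i j × lookup L i ≡ u × lookup L j ≡ v)
  Before⇒index (now v∈)  = F.zero , F.suc (index v∈) , s≤s z≤n , refl , sym (lookup-index v∈)
  Before⇒index (later b) = let (i , j , i<j , ≡u , ≡v) = Before⇒index b in F.suc i , F.suc j , s≤s i<j , ≡u , ≡v

module Loading {n : ℕ} (G : Digraph n) (s : Fin n) where
  open ChipFiring G s
  open Firing G s
  open Degrees G s

  Loadable : Fin n → Set
  Loadable v = ∀ M → ∃[ k ] ∃[ q ] (Legal (scale k β) q × M ≤ run q (scale k β) v)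

  loadable-source : ∀ {w} → Arc G s w → Loadable w
  loadable-source {w} sw M = M , [] , [] , subst (λ b → M ≤ M * bit b) (sym sw) (≤-reflexive (sym (*-identityʳ M)))

  -- Loadability propagates along arcs between non-sinks: load M · outdeg u
  -- chips on u, then fire u M times, sending M chips to w.
  loadable-step : ∀ {u w} → u ≢ s → Arc G u w → w ≢ s → Loadable u → Loadable w
  loadable-step {u} {w} u≢s uw w≢s load-u M with load-u (M * od u)
  ... | k , q , lq , enough = k , q ++ us , Legal-join q us lq lus , arrive
    where
    Y = run q (scale k β)
    us = replicate M u
    budget : ∀ x → M * δ x u * od x ≤ Y x
    budget x with x ≟ u
    ... | yes refl = ≤-trans (≤-reflexive (cong (_* od x) (*-identityʳ M))) enough
    ... | no _     = ≤-trans (≤-reflexive (cong (_* od x) (*-zeroʳ M))) z≤n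
    only-u : ∀ x → 0 < M * δ x u → x ≢ s × 1 ≤ od x
    only-u x pos with x ≟ u
    ... | yes refl = u≢s , outdeg-pos uw
    ... | no _     = ⊥-elim (<-irrefl (sym (*-zeroʳ M)) pos)
    lus : Legal Y us
    lus = Legal-budget us (λ x → subst (λ m → m * od x ≤ Y x) (sym (count-replicate x M u)) (budget x))
                          (λ x pos → only-u x (subst (0 <_) (count-replicate x M u) pos))
    received-M : received w us ≡ M
    received-M = trans (received-replicate M) (trans (cong (M *_) (gain-arc uw w≢s)) (*-identityʳ M))
      where
      received-replicate : ∀ m → received w (replicate m u) ≡ m * gain u w
      received-replicate zero    = refl
      received-replicate (suc m) = cong (gain u w +_) (received-replicate m)
    w-unfired : count w us ≡ 0
    w-unfired = trans (count-replicate w M u)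
                  (trans (cong (M *_) (δ-≢ (arc-irreflexive uw ∘ sym))) (*-zeroʳ M))
    arrive : M ≤ run (q ++ us) (scale k β) w
    arrive = begin
      M                        ≤⟨ m≤n+m M (Y w) ⟩
      Y w + M                  ≡⟨ cong (Y w +_) received-M ⟨
      Y w + received w us      ≡⟨ run-unfired lus w-unfired ⟨
      run us Y w               ≡⟨ cong (λ f → f w) (run-++ q us (scale k β)) ⟨
      run (q ++ us) (scale k β) w ∎
      where open ≤-Reasoning

module Recurrent {n : ℕ} (G : Digraph n) (s : Fin n) (conn : Connected G) (eul : Eulerian G)
                 (c : Config n) (rec : ChipFiring.Recurrent G s c) where
  open ChipFiring G s
  open Firing G s
  open Abelian G s
  open Degrees G s
  open Loading G s

  stab : Stable c
  stab = proj₁ rec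

  acc : Accessible c
  acc = proj₂ rec

  -- Accessibility from outdeg yields Z = outdeg ⊕ d₀ and a legal p from Z to c.
  private
    from-od = acc od
    Z : Config n
    Z = od ⊕ proj₁ from-od
    p : List (Fin n)
    p = proj₁ (proj₂ from-od)
    lp : Legal Z p
    lp = proj₁ (proj₂ (proj₂ from-od))
    ep : run p Z ≈ c
    ep = proj₂ (proj₂ (proj₂ from-od))

    -- In Z ⊕ β every non-sink holds its outdegree, so all non-sinks can fire
    -- once; each then receives indeg = outdeg chips back, returning to Z.
    fire-all : Legal (Z ⊕ β) nonSinks
    fire-all = Legal-budget nonSinks budget nonsink
      where
      budget : ∀ w → count w nonSinks * od w ≤ Z w + β w
      budget w = ≤-trans (*-monoˡ-≤ (od w) (count-nonSinks-≤1 w))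
                   (≤-trans (≤-reflexive (*-identityˡ (od w))) (≤-trans (m≤m+n (od w) _) (m≤m+n _ (β w))))
      nonsink : ∀ w → 0 < count w nonSinks → w ≢ s × 1 ≤ od w
      nonsink w pos = w≢s , nonsink-outdeg-pos conn eul w w≢s
        where
        w≢s : w ≢ s
        w≢s refl = <-irrefl (sym count-nonSinks-sink) pos

    fire-all-returns : run nonSinks (Z ⊕ β) ≈ Z
    fire-all-returns w w≢s = +-cancelʳ-≡ (od w) _ _ (begin
      run nonSinks (Z ⊕ β) w + od w                     ≡⟨ cong (λ k → run nonSinks (Z ⊕ β) w + k) (trans (cong (_* od w) (count-nonSinks w≢s)) (*-identityˡ (od w))) ⟨
      run nonSinks (Z ⊕ β) w + count w nonSinks * od w  ≡⟨ run-balance fire-all w ⟩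
      (Z w + β w) + received w nonSinks                 ≡⟨ x∙yz≈xz∙y (Z w) (received w nonSinks) (β w) ⟨
      Z w + (received w nonSinks + β w)                 ≡⟨ cong (Z w +_) (trans (received-nonSinks w≢s) (eul w)) ⟩
      Z w + od w                                        ∎)
      where open ≡-Reasoning

    -- Z ⊕ β reaches the stable c in two ways: fire all non-sinks and then p,
    -- or fire p first (carrying β along) to reach c ⊕ β.
    round : Legal (Z ⊕ β) (nonSinks ++ p)
    round = Legal-join nonSinks p fire-all (Legal-resp (≈-sym fire-all-returns) lp)

    round-ends : run (nonSinks ++ p) (Z ⊕ β) ≈ c
    round-ends = ≈-trans (≡⇒≈ (run-++ nonSinks p (Z ⊕ β))) (≈-trans (run-resp p fire-all-returns) ep)

    p-with-β : Legal (Z ⊕ β) p × run p (Z ⊕ β) ≈ (run p Z ⊕ β)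
    p-with-β = Legal-add lp ≈-refl

    p-ends : run p (Z ⊕ β) ≈ (c ⊕ β)
    p-ends = ≈-trans (proj₂ p-with-β) (λ w w≢s → cong (_+ β w) (ep w w≢s))

  firingSeq-exists : ∃[ ws ] FiringSeq c ws
  firingSeq-exists with complete round round-ends stab (proj₁ p-with-β)
  ... | r , lr , er , _ = r , Legal-resp p-ends lr , ≈-trans (run-resp r (≈-sym p-ends)) er

  -- Every firing sequence fires every non-sink exactly once (least action,
  -- comparing p followed by it with the round through all non-sinks).
  fires-each-once : ∀ {ws} → FiringSeq c ws → ∀ w → count w ws ≡ count w nonSinks
  fires-each-once {ws} (lws , ews) w = +-cancelˡ-≡ (count w p) _ _ (begin
    count w p + count w ws         ≡⟨ count-++ w p ws ⟨
    count w (p ++ ws)              ≡⟨ same-counts round round-ends stab lpws epws stab w ⟨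
    count w (nonSinks ++ p)        ≡⟨ count-++ w nonSinks p ⟩
    count w nonSinks + count w p   ≡⟨ +-comm (count w nonSinks) _ ⟩
    count w p + count w nonSinks   ∎)
    where
    open ≡-Reasoning
    lpws : Legal (Z ⊕ β) (p ++ ws)
    lpws = Legal-join p ws (proj₁ p-with-β) (Legal-resp (≈-sym p-ends) lws)
    epws : run (p ++ ws) (Z ⊕ β) ≈ c
    epws = ≈-trans (≡⇒≈ (run-++ p ws (Z ⊕ β))) (≈-trans (run-resp ws p-ends) ews)

  fired-once : ∀ {ws w} → FiringSeq c ws → w ≢ s → count w ws ≡ 1
  fired-once {w = w} fs w≢s = trans (fires-each-once fs w) (count-nonSinks w≢s)

  fired : ∀ {ws w} → FiringSeq c ws → w ≢ s → w ∈ ws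
  fired {ws} fs w≢s = count⇒∈ ws (≤-reflexive (sym (fired-once fs w≢s)))

  below-outdeg : ∀ {y} → y ≢ s → 1 ≤ od y → c y < od y
  below-outdeg {y} y≢s od≥1 = ≰⇒> (λ ody≤ → stab y (y≢s , od≥1 , ody≤))

  -- Along a legal run, every non-sink holding more than c chips is loadable;
  -- hence so is every fired vertex, as it holds at least outdeg > c chips.
  loadable-invariant : ∀ {Q ws} → Legal Q ws → (∀ x → x ≢ s → c x < Q x → Loadable x) →
                       ∀ x → x ∈ ws → Loadable x
  loadable-invariant ((y≢s , od≥1 , ody≤) ∷ _) inv x (here refl) =
    inv x y≢s (<-≤-trans (below-outdeg y≢s od≥1) ody≤)
  loadable-invariant {Q} {y ∷ _} ((y≢s , od≥1 , ody≤) ∷ l) inv x (there x∈) = loadable-invariant l inv′ x x∈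
    where
    inv′ : ∀ x → x ≢ s → c x < fire y Q x → Loadable x
    inv′ x x≢s more = by-arc (E G y x) refl
      where
      by-arc : ∀ b → E G y x ≡ b → Loadable x
      by-arc true  yx = loadable-step y≢s yx x≢s (inv y y≢s (<-≤-trans (below-outdeg y≢s od≥1) ody≤))
      by-arc false yx = inv x x≢s (<-≤-trans more (≤-trans (fire-≤ y Q x)
                          (≤-reflexive (trans (cong (Q x +_) (gain-nonarc yx)) (+-identityʳ _)))))

  -- Every vertex fired by a legal run from c ⊕ β is loadable: initially only
  -- the out-neighbours of s hold more than c chips.
  fired⇒loadable : ∀ {ws} → Legal (c ⊕ β) ws → ∀ x → x ∈ ws → Loadable x
  fired⇒loadable l = loadable-invariant l initial
    where
    initial : ∀ x → x ≢ s → c x < c x + β x → Loadable x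
    initial x _ more = by-arc (E G s x) refl
      where
      by-arc : ∀ b → E G s x ≡ b → Loadable x
      by-arc true  sx = loadable-source sx
      by-arc false sx = ⊥-elim (<-irrefl (sym (trans (cong (λ b → c x + bit b) sx) (+-identityʳ (c x)))) more)

  -- From d ⊕ d₁ →* c, add the chips
  -- of a load Y ≥ e_v minus e_v; this meets the run of the load from c′ ⊕ k·β,
  -- which (since c′ ⊕ k·β →* c′ stable) can be completed to c′.
  accessible-below : ∀ {c′ v π} → Stable c′ → Legal (c′ ⊕ β) π → run π (c′ ⊕ β) ≈ c′ →
                     Loadable v → (∀ w → c w ≡ c′ w + δ w v) → Accessible c′
  accessible-below {c′} {v} st′ lπ eπ load-v c≡ d =
    d₁ ⊕ rest , p₁ ++ r , Legal-join p₁ r (proj₁ p₁-with-rest) (Legal-resp (≈-sym meet) lr) ,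
    ≈-trans (≡⇒≈ (run-++ p₁ r _)) (≈-trans (run-resp r meet) er)
    where
    to-c = acc d
    d₁ = proj₁ to-c
    p₁ = proj₁ (proj₂ to-c)
    load = load-v 1
    k = proj₁ load
    q = proj₁ (proj₂ load)
    Y : Config n
    Y = run q (scale k β)
    rest : Config n
    rest w = Y w ∸ δ w v
    p₁-with-rest = Legal-add {D = rest} (proj₁ (proj₂ (proj₂ to-c))) (λ w _ → sym (+-assoc (d w) (d₁ w) (rest w)))
    q-from-c′ = Legal-add {D = c′} (proj₁ (proj₂ (proj₂ load))) (λ w _ → +-comm (c′ w) _)
    back = repeat lπ eπ k
    completion = complete (proj₁ (proj₂ back)) (proj₂ (proj₂ back)) st′ (proj₁ q-from-c′)
    r = proj₁ completion
    lr = proj₁ (proj₂ completion)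
    er = proj₁ (proj₂ (proj₂ completion))
    meet : run p₁ (d ⊕ (d₁ ⊕ rest)) ≈ run q (c′ ⊕ scale k β)
    meet w w≢s = begin
      run p₁ (d ⊕ (d₁ ⊕ rest)) w        ≡⟨ proj₂ p₁-with-rest w w≢s ⟩
      run p₁ (d ⊕ d₁) w + rest w        ≡⟨ cong (_+ rest w) (trans (proj₂ (proj₂ (proj₂ to-c)) w w≢s) (c≡ w)) ⟩
      (c′ w + δ w v) + (Y w ∸ δ w v)    ≡⟨ +-assoc (c′ w) _ _ ⟩
      c′ w + (δ w v + (Y w ∸ δ w v))    ≡⟨ cong (c′ w +_) (m+[n∸m]≡n (δ-≤ (proj₂ (proj₂ (proj₂ load))) w)) ⟩
      c′ w + Y w                        ≡⟨ +-comm (c′ w) (Y w) ⟩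
      Y w + c′ w                        ≡⟨ proj₂ q-from-c′ w w≢s ⟨
      run q (c′ ⊕ scale k β) w          ∎
      where open ≡-Reasoning

  extend-to-firingSeq : ∀ {L} → Legal (c ⊕ β) L → ∃[ a ] FiringSeq c (L ++ a)
  extend-to-firingSeq {L} lL
    with complete (proj₁ (proj₂ firingSeq-exists)) (proj₂ (proj₂ firingSeq-exists)) stab lL
  ... | a , la , ea , _ = a , Legal-join L a lL la , ≈-trans (≡⇒≈ (run-++ L a (c ⊕ β))) ea

  -- In a firing sequence P v a every non-sink fires once, so during P the
  -- vertex v receives, together with β, at most indeg v = outdeg v chips.
  -- Hence if P does not fire v yet leaves more than outdeg v chips on it,
  -- those extra chips came from c: c v ≥ 1.
  surplus⇒chip : ∀ {P v a} → v ≢ s → FiringSeq c (P ++ v ∷ a) → count v P ≡ 0 →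
                 od v < run P (c ⊕ β) v → 1 ≤ c v
  surplus⇒chip {P} {v} {a} v≢s fs cvP surplus = +-cancelʳ-< (od v) 0 (c v) (begin-strict
    od v                                  <⟨ surplus ⟩
    run P (c ⊕ β) v                       ≡⟨ run-unfired (proj₁ (Legal-split P (v ∷ a) (proj₁ fs))) cvP ⟩
    (c v + β v) + received v P            ≡⟨ +-assoc (c v) (β v) _ ⟩
    c v + (β v + received v P)            ≤⟨ +-monoʳ-≤ (c v) (+-monoʳ-≤ (β v) (received-mono v P nonSinks P≤nonSinks)) ⟩
    c v + (β v + received v nonSinks)     ≡⟨ cong (c v +_) (trans (+-comm (β v) _) (trans (received-nonSinks v≢s) (eul v))) ⟩
    c v + od v                            ∎)
    where
    open ≤-Reasoning
    P≤nonSinks : ∀ w → count w P ≤ count w nonSinks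
    P≤nonSinks w = subst (count w P ≤_) (trans (sym (count-++ w P (v ∷ a))) (fires-each-once fs w)) (m≤m+n _ _)

  -- Extend P v to a firing sequence π.
  decrement : ∀ {P v} → v ≢ s → Legal (c ⊕ β) P → count v P ≡ 0 → od v < run P (c ⊕ β) v →
              ∃[ c′ ] Recurrent c′ × c′ ≤ᶜ c × c′ v < c v
  decrement {P} {v} v≢s lP cvP surplus = c′ , (stable′ , accessible′) , (λ w _ → m∸n≤m (c w) (δ w v)) , c′v<cv
    where
    fire-v : Active v (run P (c ⊕ β))
    fire-v = v≢s , nonsink-outdeg-pos conn eul v v≢s , <⇒≤ surplus
    extension = extend-to-firingSeq (Legal-join P (v ∷ []) lP (fire-v ∷ []))
    a = proj₁ extension
    fsπ : FiringSeq c (P ++ v ∷ a)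
    fsπ = subst (FiringSeq c) (++-assoc P (v ∷ []) a) (proj₂ extension)
    cva : count v a ≡ 0
    cva = suc-injective (begin
      suc (count v a)                  ≡⟨ cong₂ (λ k d → k + (d + count v a)) cvP (δ-refl v) ⟨
      count v P + (δ v v + count v a)  ≡⟨ count-++ v P (v ∷ a) ⟨
      count v (P ++ v ∷ a)             ≡⟨ fired-once fsπ v≢s ⟩
      1                                ∎)
      where open ≡-Reasoning
    c′ : Config n
    c′ w = c w ∸ δ w v
    c≡ : ∀ w → c w ≡ c′ w + δ w v
    c≡ w = sym (m∸n+n≡m (δ-≤ (surplus⇒chip v≢s fsπ cvP surplus) w))
    X≈ : (c ⊕ β) ≈ ((c′ ⊕ β) ⊕ unit v)
    X≈ w _ = trans (cong (_+ β w) (c≡ w)) (xy∙z≈xz∙y (c′ w) (δ w v) (β w))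
    removed = remove-surplus-chip P a X≈ (proj₁ fsπ) cvP cva surplus
    returns′ : run (P ++ v ∷ a) (c′ ⊕ β) ≈ c′
    returns′ w w≢s = +-cancelʳ-≡ (δ w v) _ _
      (trans (sym (proj₂ removed w w≢s)) (trans (proj₂ fsπ w w≢s) (c≡ w)))
    stable′ : Stable c′
    stable′ w (w≢s , od≥1 , odw≤) = stab w (w≢s , od≥1 , ≤-trans odw≤ (m∸n≤m (c w) (δ w v)))
    accessible′ : Accessible c′
    accessible′ = accessible-below stable′ (proj₁ removed) returns′
                    (fired⇒loadable (proj₁ fsπ) v (fired fsπ v≢s)) c≡
    c′v<cv : c′ v < c v
    c′v<cv = subst (c′ v <_) (sym (trans (c≡ v) (cong (c′ v +_) (δ-refl v)))) (m<m+n (c′ v) (s≤s z≤n))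

module Minimal {n : ℕ} (G : Digraph n) (s : Fin n) (conn : Connected G) (eul : Eulerian G)
               (c : Config n) (mr : ChipFiring.MinimalRecurrent G s c) where
  open ChipFiring G s
  open Firing G s
  open Abelian G s
  open Degrees G s
  open Recurrent G s conn eul c (proj₁ mr)

  -- No arc u → v between non-sinks is fired as u-then-v by one firing
  -- sequence and v-then-u by another: write σ = C v D with u ∈ C and
  -- τ = A v B with u ∈ B; the surplus prefix built from C and A allows
  -- removing a chip from v, against minimality.
  no-inversion : ∀ {u v σ τ} → FiringSeq c σ → FiringSeq c τ → Arc G u v → u ≢ s → v ≢ s →
                 Before u v σ → Before v u τ → ⊥
  no-inversion {u} {v} fsσ fsτ uv u≢s v≢s uv∈σ vu∈τ with split-at-later uv∈σ | split-at-earlier vu∈τ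
  ... | C , D , refl , u∈C | A , B , refl , u∈B =
    <-irrefl (proj₂ mr c′ rec′ c′≤c v v≢s) c′v<cv
    where
    cvC : count v C ≡ 0
    cvC = once-later v C (v ∷ D) (fired-once fsσ v≢s) (∈⇒count {l = v ∷ D} (here refl))
    cvA : count v A ≡ 0
    cvA = once-later v A (v ∷ B) (fired-once fsτ v≢s) (∈⇒count {l = v ∷ B} (here refl))
    cuA : count u A ≡ 0
    cuA = once-later u A (v ∷ B) (fired-once fsτ u≢s) (∈⇒count (there u∈B))
    lA = Legal-split A (v ∷ B) (proj₁ fsτ)
    v-active : Active v (run A (c ⊕ β))
    v-active with proj₂ lA
    ... | act ∷ _ = act
    prefix = surplus-prefix (proj₁ lA) (proj₁ (Legal-split C (v ∷ D) (proj₁ fsσ))) v-active uv cvA cvC cuA u∈C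
    smaller = decrement v≢s (proj₁ (proj₂ prefix)) (proj₁ (proj₂ (proj₂ prefix))) (proj₂ (proj₂ (proj₂ prefix)))
    c′ = proj₁ smaller
    rec′ = proj₁ (proj₂ smaller)
    c′≤c = proj₁ (proj₂ (proj₂ smaller))
    c′v<cv = proj₂ (proj₂ (proj₂ smaller))

  -- Every arc of the firing graph of σ is an arc of the firing graph of τ:
  -- both fire all non-sinks, and arcs between them keep their order.
  same-arcs : ∀ {σ τ} → FiringSeq c σ → FiringSeq c τ → ∀ u v → FGArc σ u v → FGArc τ u v
  same-arcs fsσ fsτ u v (inj₁ (refl , v∈σ) , sv) = inj₁ (refl , fired fsτ (Legal-nonsink (proj₁ fsσ) v∈σ)) , sv
  same-arcs {σ} {τ} fsσ fsτ u v (inj₂ (i , j , i<j , ≡u , ≡v) , uv) =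
    inj₂ (ordered (Legal-nonsink (proj₁ fsσ) (proj₁ (Before-∈ uv∈σ)))
                  (Legal-nonsink (proj₁ fsσ) (proj₂ (Before-∈ uv∈σ)))) , uv
    where
    uv∈σ = index⇒Before σ i j i<j ≡u ≡v
    ordered : u ≢ s → v ≢ s → ∃[ i ] ∃[ j ] (F._<_ {length τ} i j × lookup τ i ≡ u × lookup τ j ≡ v)
    ordered u≢s v≢s with Before-dichotomy τ (fired fsτ u≢s) (fired fsτ v≢s) (arc-irreflexive uv)
    ... | inj₁ uv∈τ = Before⇒index uv∈τ
    ... | inj₂ vu∈τ = ⊥-elim (no-inversion fsσ fsτ uv u≢s v≢s uv∈σ vu∈τ)

  unique-firing-graph : UniqueFiringGraph c
  unique-firing-graph = firingSeq-exists , λ σ τ fsσ fsτ u v → same-arcs fsσ fsτ u v , same-arcs fsτ fsσ u v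

lemma13 : ∀ {n} (G : Digraph n) (s : Fin n) → Connected G → Eulerian G →
          ∀ c → ChipFiring.MinimalRecurrent G s c → ChipFiring.UniqueFiringGraph G s c
lemma13 G s conn eul c mr = Minimal.unique-firing-graph G s conn eul c mr
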